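{- Let $\mathcal{L}$ be a language of binding logic and $\Gamma$, $\Delta$ multisets of propositions of $\mathcal{L}$. If for every model of the theory modulo $\langle\Gamma',\equiv\rangle$ there is a proposition in $\Delta'$ that is valid, then for every binding model of $\Gamma$ there is a proposition in $\Delta$ that is valid.
   Context: Binding logic, binding models: a language assigns each function/predicate symbol a binding arity $\langle k_1,\ldots,k_n\rangle$ (in $f(x^1_1\cdots x^1_{k_1}t_1,\ldots)$ the $x^i_j$ are bound in $t_i$). An intensional functional structure is a family of sets $M_0,M_1,\ldots$ with elements $\mathbf{1}_n,\ldots,\mathbf{n}_n\in M_n$ and maps $\Box_{p,n}:M_n\times M_p^n\to M_p$ satisfying $\mathbf{i}_n\Box\langle a_1,\ldots,a_n\rangle=a_i$, $a\Box_{n,n}\langle\mathbf{1}_n,\ldots,\mathbf{n}_n\rangle=a$, and associativity $(a\Box\langle b_1,\ldots,b_n\rangle)\Box\langle c\rangle=a\Box\langle b_1\Box\langle c\rangle,\ldots,b_n\Box\langle c\rangle\rangle$. A binding model adds, for each function symbol of binding arity $\langle k_1,\ldots,k_n\rangle$, maps $\hat f_p:\prod_i M_{p+k_i}\to M_p$ with $\hat f_p(a_1,\ldots,a_n)\Box_{q,p}\langle b_1,\ldots,b_p\rangle=\hat f_q(\ldots,a_i\Box_{q+k_i,p+k_i}\langle\mathbf{1}_{q+k_i},\ldots,\mathbf{k_i}_{q+k_i},b_1\Box_{q+k_i,q}S_i,\ldots,b_p\Box_{q+k_i,q}S_i\rangle,\ldots)$, $S_i=\langle\mathbf{(1+k_i)}_{q+k_i},\ldots,\mathbf{(q+k_i)}_{q+k_i}\rangle$;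 and for each predicate symbol $\hat P:\prod_iM_{k_i}\to\{0,1\}$. Denotation relative to a list $x_1,\ldots,x_p$ and assignment $\phi$ into $M_0$: $[\![x_k]\!]=\mathbf{k}_p$, $[\![y]\!]=\phi(y)\Box_{p,0}\langle\rangle$ for other $y$, $[\![f(y^1_1\cdots y^1_{k_1}t_1,\ldots)]\!]^{x_1..x_p}_\phi=\hat f_p([\![t_1]\!]^{y^1_{k_1},\ldots,y^1_1,x_1,\ldots,x_p}_\phi,\ldots)$, $[\![P(y^1_1\cdots y^1_{k_1}t_1,\ldots)]\!]_\phi=\hat P([\![t_1]\!]^{y^1_{k_1},\ldots,y^1_1}_\phi,\ldots)$, classical connectives, quantifiers over $M_0$. Valid = denotation $1$ (under every assignment); a model of $\Gamma$ is one where all propositions of $\Gamma$ are valid. Translation: many-sorted language $\mathcal{L}'$ with sorts $n$, $\langle n,p\rangle$; symbols $f_p$ (rank $\langle k_1+p,\ldots,k_n+p\rangle\to p$), predicates $P$ (rank $\langle k_1,\ldots,k_n\rangle$), $1_n,\ldots,n_n:n$, $t[s]$ with $[\,]_{n,p}:\langle p,\langle n,p\rangle\rangle\to n$, $id_n:\langle n,n\rangle$, $t.s$ with $\cdot_{n,p}:\langle n,\langle n,p\rangle\rangle\to\langle n,p+1\rangle$, $\uparrow_n:\langle n+1,n\rangle$, $\circ_{n,p,q}:\langle\langle p,n\rangle,\langle q,p\rangle\rangle\to\langle q,n\rangle$; $\uparrow^m=\uparrow_0\circ\cdots\circ\uparrow_{m-1}$. Pre-cooking $F$: $F(x,l)=n_{|l|}$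 if $x$ first occurs at position $n$ of $l$, else $x[\uparrow^{|l|}]$; $F(f(x^1_1\cdots x^1_{k_1}t_1,\ldots),l)=f_{|l|}(F(t_1,x^1_{k_1}\cdots x^1_1.l),\ldots)$; $F(P(\ldots),\epsilon)=P(F(t_1,x^1_{k_1}\cdots x^1_1),\ldots)$; $F$ commutes with connectives/quantifiers; $A'=F(A,\epsilon)$, $\Gamma'=\{A':A\in\Gamma\}$. $\equiv$ is the congruence generated by $\sigma$: $n+1\to1[\uparrow^n]$; $1[t.s]\to t$; $t[id]\to t$; $(t[s])[s']\to t[s\circ s']$; $id\circ s\to s$; $\uparrow\circ(t.s)\to s$; $(s_1\circ s_2)\circ s_3\to s_1\circ(s_2\circ s_3)$; $(t.s)\circ s'\to t[s'].(s\circ s')$; $s\circ id\to s$; $1.\uparrow\to id$; $1[s].(\uparrow\circ s)\to s$; $f_p(t_1,\ldots,t_n)[s]\to f_q(t_1[1.1[\uparrow].\cdots.1[\uparrow^{k_1-1}].s\circ\uparrow^{k_1}],\ldots)$ ($s$ of sort $\langle q,p\rangle$). A model of the theory modulo $\langle\Gamma',\equiv\rangle$ is a standard many-sorted model of $\mathcal{L}'$ in which all propositions of $\Gamma'$ are valid and congruent terms/propositions have the same denotation. -}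

module Defs where

open import Data.Nat using (ℕ; zero; suc; _+_; _≡ᵇ_; _≟_)
open import Data.Nat.Properties using (+-suc)
open import Data.Fin using (Fin; zero; suc; _↑ˡ_; _↑ʳ_)
open import Data.Vec using (Vec; []; _∷_; _++_; reverse; lookup; tabulate)
import Data.Vec as Vec
open import Data.List using (List; []; _∷_)
open import Data.List.Membership.Propositional using (_∈_)
open import Data.Maybe using (Maybe; just; nothing; maybe′)
import Data.Maybe as Maybe
open import Data.Bool using (Bool; true; false; if_then_else_)
open import Data.Product using (_×_; _,_; Σ)
open import Data.Sum using (_⊎_)
open import Data.Unit using (⊤; tt)
open import Data.Empty using (⊥)
open import Relation.Nullary using (¬_; yes; no)
open import Relation.Binary.Definitions using (DecidableEquality)
open import Relation.Binary.PropositionalEquality using (_≡_; refl; subst; sym; trans)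

Prod : (ℕ → Set) → List ℕ → Set
Prod F []       = ⊤
Prod F (k ∷ ks) = F k × Prod F ks

mapProd : {F G : ℕ → Set} → (∀ k → F k → G k) → ∀ ks → Prod F ks → Prod G ks
mapProd h []       tt       = tt
mapProd h (k ∷ ks) (a , as) = h k a , mapProd h ks as

firstPos : ℕ → ∀ {p} → Vec ℕ p → Maybe (Fin p)
firstPos x []      = nothing
firstPos x (y ∷ l) = if x ≡ᵇ y then just zero else Maybe.map suc (firstPos x l)

-- Languages of binding logic: each symbol has a binding arity ⟨k₁,…,kₙ⟩

record Lang : Set₁ where
  field
    FunSym  : Set
    funAr   : FunSym → List ℕ
    PredSym : Set
    predAr  : PredSym → List ℕ

record IFS : Set₁ where
  field
    M    : ℕ → Set
    proj : (n : ℕ) → Fin n → M n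
    box  : (p n : ℕ) → M n → Vec (M p) n → M p
    box-proj  : ∀ p n (i : Fin n) (as : Vec (M p) n) → box p n (proj n i) as ≡ lookup as i
    box-id    : ∀ n (a : M n) → box n n a (tabulate (proj n)) ≡ a
    box-assoc : ∀ q p n (a : M n) (bs : Vec (M p) n) (cs : Vec (M q) p) →
                box q p (box p n a bs) cs ≡ box q n a (Vec.map (λ b → box q p b cs) bs)

  Sft : (k q : ℕ) → Vec (M (k + q)) q
  Sft k q = tabulate (λ j → proj (k + q) (k ↑ʳ j))

  liftV : (k q p : ℕ) → Vec (M q) p → Vec (M (k + q)) (k + p)
  liftV k q p bs = tabulate (λ j → proj (k + q) (j ↑ˡ q))
                   ++ Vec.map (λ b → box (k + q) q b (Sft k q)) bs

module _ (L : Lang) where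
  open Lang L

  record BindingModel : Set₁ where
    field
      ifs : IFS
    open IFS ifs public
    field
      fhat : (f : FunSym) (p : ℕ) → Prod (λ k → M (k + p)) (funAr f) → M p
      fhat-box : ∀ f p q (as : Prod (λ k → M (k + p)) (funAr f)) (bs : Vec (M q) p) →
                 box q p (fhat f p as) bs
                 ≡ fhat f q (mapProd (λ k a → box (k + q) (k + p) a (liftV k q p bs)) (funAr f) as)
      Phat : (P : PredSym) → Prod M (predAr P) → Bool

  mutual
    data Term : Set where
      var : ℕ → Term
      app : (f : FunSym) → Args (funAr f) → Term

    -- f(y¹₁⋯y¹_{k₁} t₁, …) : the i-th argument is a vector of k_i bound variables and a term
    data Args : List ℕ → Set where
      []  : Args []
      arg : ∀ {k ks} → Vec ℕ k → Term → Args ks → Args (k ∷ ks)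

  data Formula : Set where
    atom     : (P : PredSym) → Args (predAr P) → Formula
    ⊤f ⊥f    : Formula
    ¬f       : Formula → Formula
    _∧f_ _∨f_ _⇒f_ : Formula → Formula → Formula
    ∀f ∃f    : ℕ → Formula → Formula

  module _ (𝓜 : BindingModel) where
    open BindingModel 𝓜

    updB : (ℕ → M 0) → ℕ → M 0 → (ℕ → M 0)
    updB φ x a y = if y ≡ᵇ x then a else φ y

    mutual
      ⟦_⟧t : Term → ∀ {p} → Vec ℕ p → (ℕ → M 0) → M p
      ⟦ var x ⟧t {p} l φ = maybe′ (proj p) (box p 0 (φ x) []) (firstPos x l)
      ⟦ app f as ⟧t {p} l φ = fhat f p (⟦ as ⟧as l φ)

      ⟦_⟧as : ∀ {ks} → Args ks → ∀ {p} → Vec ℕ p → (ℕ → M 0) → Prod (λ k → M (k + p)) ks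
      ⟦ [] ⟧as l φ = tt
      ⟦ arg ys t as ⟧as l φ = ⟦ t ⟧t (reverse ys ++ l) φ , ⟦ as ⟧as l φ

    ⟦_⟧pa : ∀ {ks} → Args ks → (ℕ → M 0) → Prod M ks
    ⟦ [] ⟧pa φ = tt
    ⟦ arg ys t as ⟧pa φ = ⟦ t ⟧t (reverse ys) φ , ⟦ as ⟧pa φ

    ⟦_⟧f : Formula → (ℕ → M 0) → Set
    ⟦ atom P as ⟧f φ = Phat P (⟦ as ⟧pa φ) ≡ true
    ⟦ ⊤f ⟧f φ = ⊤
    ⟦ ⊥f ⟧f φ = ⊥
    ⟦ ¬f A ⟧f φ = ¬ ⟦ A ⟧f φ
    ⟦ A ∧f B ⟧f φ = ⟦ A ⟧f φ × ⟦ B ⟧f φ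
    ⟦ A ∨f B ⟧f φ = ⟦ A ⟧f φ ⊎ ⟦ B ⟧f φ
    ⟦ A ⇒f B ⟧f φ = ⟦ A ⟧f φ → ⟦ B ⟧f φ
    ⟦ ∀f x A ⟧f φ = (a : M 0) → ⟦ A ⟧f (updB φ x a)
    ⟦ ∃f x A ⟧f φ = Σ (M 0) λ a → ⟦ A ⟧f (updB φ x a)

    Valid : Formula → Set
    Valid A = (φ : ℕ → M 0) → ⟦ A ⟧f φ

    IsModelOf : List Formula → Set
    IsModelOf Γ = ∀ A → A ∈ Γ → Valid A

  -- The many-sorted language L'
  -- sorts: n  (tm n)  and  ⟨n,p⟩  (sb n p)

  data Sort : Set where
    tm : ℕ → Sort
    sb : ℕ → ℕ → Sort

  infixl 8 _[_]
  infixr 7 _∙_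
  infixl 6 _∘ₛ_

  mutual
    data Tm : Sort → Set where
      var  : ∀ {s} → ℕ → Tm s
      fn   : (f : FunSym) (p : ℕ) → TArgs p (funAr f) → Tm (tm p)
      cst  : (n : ℕ) → Fin n → Tm (tm n)
      _[_] : ∀ {n p} → Tm (tm p) → Tm (sb n p) → Tm (tm n)
      idₛ  : (n : ℕ) → Tm (sb n n)
      _∙_  : ∀ {n p} → Tm (tm n) → Tm (sb n p) → Tm (sb n (suc p))
      up   : (n : ℕ) → Tm (sb (suc n) n)
      _∘ₛ_ : ∀ {n p q} → Tm (sb p n) → Tm (sb q p) → Tm (sb q n)

    data TArgs (p : ℕ) : List ℕ → Set where
      []  : TArgs p []
      _∷_ : ∀ {k ks} → Tm (tm (k + p)) → TArgs p ks → TArgs p (k ∷ ks)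

  data PArgs : List ℕ → Set where
    []  : PArgs []
    _∷_ : ∀ {k ks} → Tm (tm k) → PArgs ks → PArgs (k ∷ ks)

  data Fm : Set where
    atom     : (P : PredSym) → PArgs (predAr P) → Fm
    ⊤f ⊥f    : Fm
    ¬f       : Fm → Fm
    _∧f_ _∨f_ _⇒f_ : Fm → Fm → Fm
    ∀f ∃f    : Sort → ℕ → Fm → Fm

  up0 : (m : ℕ) → Tm (sb m 0)
  up0 zero = idₛ 0
  up0 (suc zero) = up 0
  up0 (suc (suc m)) = up0 (suc m) ∘ₛ up (suc m)

  sh : (r j : ℕ) → Tm (sb (j + r) r)
  sh r zero = idₛ r
  sh r (suc zero) = up r
  sh r (suc (suc j)) = sh r (suc j) ∘ₛ up (suc j + r)

  castTm : ∀ {m n} → m ≡ n → Tm (tm m) → Tm (tm n)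
  castTm eq t = subst (λ n → Tm (tm n)) eq t

  entry : (r j : ℕ) → Tm (tm (j + suc r))
  entry r zero    = cst (suc r) zero
  entry r (suc j) = cst (suc r) zero [ sh (suc r) (suc j) ]

  chainFrom : ∀ {N p} (q j m : ℕ) → j + (m + q) ≡ N → Tm (sb N p) → Tm (sb N (m + p))
  chainFrom q j zero eq tl = tl
  chainFrom q j (suc m) eq tl =
    castTm eq (entry (m + q) j) ∙ chainFrom q (suc j) m (trans (sym (+-suc j (m + q))) eq) tl

  chain : ∀ {q p} (k : ℕ) → Tm (sb q p) → Tm (sb (k + q) (k + p))
  chain {q} k s = chainFrom q 0 k refl (s ∘ₛ sh q k)

  pushArgs : ∀ {p q ks} → Tm (sb q p) → TArgs p ks → TArgs q ks
  pushArgs s [] = []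
  pushArgs s (_∷_ {k} t ts) = (t [ chain k s ]) ∷ pushArgs s ts

  data Rule : ∀ {s} → Tm s → Tm s → Set where
    r-varshift : ∀ {r n} →
      Rule (cst (suc n + suc r) (suc n ↑ʳ zero)) (cst (suc r) zero [ sh (suc r) (suc n) ])
    r-varcons  : ∀ {n p} (t : Tm (tm n)) (s : Tm (sb n p)) → Rule (cst (suc p) zero [ t ∙ s ]) t
    r-id       : ∀ {n} (t : Tm (tm n)) → Rule (t [ idₛ n ]) t
    r-clos     : ∀ {m n p} (t : Tm (tm p)) (s : Tm (sb n p)) (s' : Tm (sb m n)) →
                 Rule ((t [ s ]) [ s' ]) (t [ s ∘ₛ s' ])
    r-idl      : ∀ {n q} (s : Tm (sb q n)) → Rule (idₛ n ∘ₛ s) s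
    r-shiftcons : ∀ {n q} (t : Tm (tm q)) (s : Tm (sb q n)) → Rule (up n ∘ₛ (t ∙ s)) s
    r-ass      : ∀ {n p q r} (s₁ : Tm (sb p n)) (s₂ : Tm (sb q p)) (s₃ : Tm (sb r q)) →
                 Rule ((s₁ ∘ₛ s₂) ∘ₛ s₃) (s₁ ∘ₛ (s₂ ∘ₛ s₃))
    r-map      : ∀ {n p q} (t : Tm (tm n)) (s : Tm (sb n p)) (s' : Tm (sb q n)) →
                 Rule ((t ∙ s) ∘ₛ s') ((t [ s' ]) ∙ (s ∘ₛ s'))
    r-idr      : ∀ {n p} (s : Tm (sb p n)) → Rule (s ∘ₛ idₛ p) s
    r-varid    : ∀ {n} → Rule (cst (suc n) zero ∙ up n) (idₛ (suc n))
    r-scons    : ∀ {n q} (s : Tm (sb q (suc n))) →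
                 Rule ((cst (suc n) zero [ s ]) ∙ (up n ∘ₛ s)) s
    r-fun      : ∀ (f : FunSym) p q (ts : TArgs p (funAr f)) (s : Tm (sb q p)) →
                 Rule (fn f p ts [ s ]) (fn f q (pushArgs s ts))

  infix 4 _≈_ _≈A_ _≈PA_ _≈F_
  mutual
    data _≈_ : ∀ {s} → Tm s → Tm s → Set where
      rule     : ∀ {s} {t u : Tm s} → Rule t u → t ≈ u
      ≈-refl   : ∀ {s} {t : Tm s} → t ≈ t
      ≈-sym    : ∀ {s} {t u : Tm s} → t ≈ u → u ≈ t
      ≈-trans  : ∀ {s} {t u v : Tm s} → t ≈ u → u ≈ v → t ≈ v
      fn-cong  : ∀ {f p} {ts us : TArgs p (funAr f)} → ts ≈A us → fn f p ts ≈ fn f p us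
      sub-cong : ∀ {n p} {t t' : Tm (tm p)} {s s' : Tm (sb n p)} → t ≈ t' → s ≈ s' → t [ s ] ≈ t' [ s' ]
      cons-cong : ∀ {n p} {t t' : Tm (tm n)} {s s' : Tm (sb n p)} → t ≈ t' → s ≈ s' → t ∙ s ≈ t' ∙ s'
      comp-cong : ∀ {n p q} {s₁ s₁' : Tm (sb p n)} {s₂ s₂' : Tm (sb q p)} →
                  s₁ ≈ s₁' → s₂ ≈ s₂' → s₁ ∘ₛ s₂ ≈ s₁' ∘ₛ s₂'

    data _≈A_ {p : ℕ} : ∀ {ks} → TArgs p ks → TArgs p ks → Set where
      []  : [] ≈A []
      _∷_ : ∀ {k ks} {t u : Tm (tm (k + p))} {ts us : TArgs p ks} → t ≈ u → ts ≈A us → (t ∷ ts) ≈A (u ∷ us)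

  data _≈PA_ : ∀ {ks} → PArgs ks → PArgs ks → Set where
    []  : [] ≈PA []
    _∷_ : ∀ {k ks} {t u : Tm (tm k)} {ts us : PArgs ks} → t ≈ u → ts ≈PA us → (t ∷ ts) ≈PA (u ∷ us)

  data _≈F_ : Fm → Fm → Set where
    ≈F-refl  : ∀ {A} → A ≈F A
    ≈F-sym   : ∀ {A B} → A ≈F B → B ≈F A
    ≈F-trans : ∀ {A B C} → A ≈F B → B ≈F C → A ≈F C
    atom-cong : ∀ {P} {as bs : PArgs (predAr P)} → as ≈PA bs → atom P as ≈F atom P bs
    ¬-cong   : ∀ {A B} → A ≈F B → ¬f A ≈F ¬f B
    ∧-cong   : ∀ {A A' B B'} → A ≈F A' → B ≈F B' → (A ∧f B) ≈F (A' ∧f B')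
    ∨-cong   : ∀ {A A' B B'} → A ≈F A' → B ≈F B' → (A ∨f B) ≈F (A' ∨f B')
    ⇒-cong   : ∀ {A A' B B'} → A ≈F A' → B ≈F B' → (A ⇒f B) ≈F (A' ⇒f B')
    ∀-cong   : ∀ {s x A B} → A ≈F B → ∀f s x A ≈F ∀f s x B
    ∃-cong   : ∀ {s x A B} → A ≈F B → ∃f s x A ≈F ∃f s x B

  mutual
    cook : Term → ∀ {p} → Vec ℕ p → Tm (tm p)
    cook (var x) {p} l = maybe′ (cst p) (var {tm 0} x [ up0 p ]) (firstPos x l)
    cook (app f as) {p} l = fn f p (cookArgs as l)

    cookArgs : ∀ {ks} → Args ks → ∀ {p} → Vec ℕ p → TArgs p ks
    cookArgs [] l = []
    cookArgs (arg ys t as) l = cook t (reverse ys ++ l) ∷ cookArgs as l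

  cookPArgs : ∀ {ks} → Args ks → PArgs ks
  cookPArgs [] = []
  cookPArgs (arg ys t as) = cook t (reverse ys) ∷ cookPArgs as

  translate : Formula → Fm
  translate (atom P as) = atom P (cookPArgs as)
  translate ⊤f = ⊤f
  translate ⊥f = ⊥f
  translate (¬f A) = ¬f (translate A)
  translate (A ∧f B) = translate A ∧f translate B
  translate (A ∨f B) = translate A ∨f translate B
  translate (A ⇒f B) = translate A ⇒f translate B
  translate (∀f x A) = ∀f (tm 0) x (translate A)
  translate (∃f x A) = ∃f (tm 0) x (translate A)

  record Model' : Set₁ where
    field
      D      : Sort → Set
      fnI    : (f : FunSym) (p : ℕ) → Prod (λ k → D (tm (k + p))) (funAr f) → D (tm p)
      predI  : (P : PredSym) → Prod (λ k → D (tm k)) (predAr P) → Bool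
      cstI   : (n : ℕ) → Fin n → D (tm n)
      substI : (n p : ℕ) → D (tm p) → D (sb n p) → D (tm n)
      idI    : (n : ℕ) → D (sb n n)
      consI  : (n p : ℕ) → D (tm n) → D (sb n p) → D (sb n (suc p))
      upI    : (n : ℕ) → D (sb (suc n) n)
      compI  : (n p q : ℕ) → D (sb p n) → D (sb q p) → D (sb q n)

  _≟S_ : DecidableEquality Sort
  tm m ≟S tm n with m ≟ n
  ... | yes refl = yes refl
  ... | no ne = no λ { refl → ne refl }
  tm _ ≟S sb _ _ = no λ ()
  sb _ _ ≟S tm _ = no λ ()
  sb m p ≟S sb n q with m ≟ n | p ≟ q
  ... | yes refl | yes refl = yes refl
  ... | no ne | _ = no λ { refl → ne refl }
  ... | yes _ | no ne = no λ { refl → ne refl }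

  module _ (𝓜 : Model') where
    open Model' 𝓜

    Asg : Set
    Asg = (s : Sort) → ℕ → D s

    updM : Asg → (s : Sort) → ℕ → D s → Asg
    updM ψ s x a s' y with s ≟S s'
    ... | yes refl = if y ≡ᵇ x then a else ψ s y
    ... | no _ = ψ s' y

    mutual
      ⟦_⟧T : ∀ {s} → Tm s → Asg → D s
      ⟦ var {s} x ⟧T ψ = ψ s x
      ⟦ fn f p ts ⟧T ψ = fnI f p (⟦ ts ⟧TA ψ)
      ⟦ cst n i ⟧T ψ = cstI n i
      ⟦ _[_] {n} {p} t s ⟧T ψ = substI n p (⟦ t ⟧T ψ) (⟦ s ⟧T ψ)
      ⟦ idₛ n ⟧T ψ = idI n
      ⟦ _∙_ {n} {p} t s ⟧T ψ = consI n p (⟦ t ⟧T ψ) (⟦ s ⟧T ψ)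
      ⟦ up n ⟧T ψ = upI n
      ⟦ _∘ₛ_ {n} {p} {q} s₁ s₂ ⟧T ψ = compI n p q (⟦ s₁ ⟧T ψ) (⟦ s₂ ⟧T ψ)

      ⟦_⟧TA : ∀ {p ks} → TArgs p ks → Asg → Prod (λ k → D (tm (k + p))) ks
      ⟦ [] ⟧TA ψ = tt
      ⟦ t ∷ ts ⟧TA ψ = ⟦ t ⟧T ψ , ⟦ ts ⟧TA ψ

    ⟦_⟧PA : ∀ {ks} → PArgs ks → Asg → Prod (λ k → D (tm k)) ks
    ⟦ [] ⟧PA ψ = tt
    ⟦ t ∷ ts ⟧PA ψ = ⟦ t ⟧T ψ , ⟦ ts ⟧PA ψ

    ⟦_⟧F : Fm → Asg → Set
    ⟦ atom P as ⟧F ψ = predI P (⟦ as ⟧PA ψ) ≡ true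
    ⟦ ⊤f ⟧F ψ = ⊤
    ⟦ ⊥f ⟧F ψ = ⊥
    ⟦ ¬f A ⟧F ψ = ¬ ⟦ A ⟧F ψ
    ⟦ A ∧f B ⟧F ψ = ⟦ A ⟧F ψ × ⟦ B ⟧F ψ
    ⟦ A ∨f B ⟧F ψ = ⟦ A ⟧F ψ ⊎ ⟦ B ⟧F ψ
    ⟦ A ⇒f B ⟧F ψ = ⟦ A ⟧F ψ → ⟦ B ⟧F ψ
    ⟦ ∀f s x A ⟧F ψ = (a : D s) → ⟦ A ⟧F (updM ψ s x a)
    ⟦ ∃f s x A ⟧F ψ = Σ (D s) λ a → ⟦ A ⟧F (updM ψ s x a)

    Valid' : Fm → Set
    Valid' A = (ψ : Asg) → ⟦ A ⟧F ψ

    record IsModelModulo (Γ' : List Fm) : Set where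
      field
        congr-tm : ∀ {s} {t u : Tm s} → t ≈ u → (ψ : Asg) → ⟦ t ⟧T ψ ≡ ⟦ u ⟧T ψ
        congr-fm : ∀ {A B} → A ≈F B → (ψ : Asg) → (⟦ A ⟧F ψ → ⟦ B ⟧F ψ) × (⟦ B ⟧F ψ → ⟦ A ⟧F ψ)
        valid-Γ' : ∀ A → A ∈ Γ' → Valid' A

-- A binding model is itself a model of the theory modulo: interpret the sort n by M n, the
-- sort ⟨n,p⟩ by Vec (M n) p, closure t[s] by □, and composition of substitutions by □ applied
-- componentwise.  The three laws of an intensional functional structure, together with the
-- commutation of each f̂ with □, validate every rule of σ, and pre-cooking commutes with
-- denotation, so A' holds in this model exactly when A holds in the binding model.
module Submission where

open import Defs
open import Data.List using (List; map)
open import Data.List.Relation.Unary.Any using (Any)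
open import Data.List.Membership.Propositional using (_∈_)
import Data.List.Relation.Unary.Any as Any
import Data.List.Relation.Unary.Any.Properties as Any
open import Data.List.Membership.Propositional.Properties using (∈-map⁻)
open import Data.Nat using (ℕ; zero; suc; _+_)
open import Data.Nat.Properties using (+-suc)
open import Data.Fin using (Fin; zero; suc; _↑ˡ_; _↑ʳ_; toℕ)
open import Data.Fin.Properties using (toℕ-injective; toℕ-↑ˡ; toℕ-↑ʳ; toℕ-cast; subst-is-cast)
open import Data.Vec using (Vec; []; _∷_; _++_; lookup; tabulate; replicate)
import Data.Vec as Vec
open import Data.Vec.Properties
  using (map-∘; map-cong; map-id; lookup∘tabulate; tabulate∘lookup; tabulate-∘; tabulate-cong)
open import Data.Maybe using (just; nothing)
open import Data.Product using (Σ; _×_; _,_)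
open import Data.Product.Function.NonDependent.Propositional using (_×-⇔_)
open import Data.Product.Function.Dependent.Propositional using (Σ-⇔)
open import Data.Sum.Function.Propositional using (_⊎-⇔_)
open import Data.Bool using (true)
open import Function.Bundles using (_⇔_; mk⇔; Equivalence)
open import Function.Construct.Identity using (⇔-id; ↠-id)
open import Function.Construct.Symmetry using (⇔-sym)
open import Function.Construct.Composition using (_⇔-∘_)
open import Function.Related.Propositional using (≡⇒)
open import Function.Related.TypeIsomorphisms using (→-cong-⇔; ¬-cong-⇔)
open import Relation.Binary.PropositionalEquality

Π-⇔ : {X : Set} {A B : X → Set} → (∀ x → A x ⇔ B x) → ((x : X) → A x) ⇔ ((x : X) → B x)
Π-⇔ A⇔B = mk⇔ (λ f x → Equivalence.to (A⇔B x) (f x)) (λ g x → Equivalence.from (A⇔B x) (g x))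

[]-unique : {A : Set} (v : Vec A 0) → v ≡ []
[]-unique [] = refl

toℕ-subst : ∀ {m n} (eq : m ≡ n) (i : Fin m) → toℕ (subst Fin eq i) ≡ toℕ i
toℕ-subst eq i = trans (cong toℕ (subst-is-cast eq i)) (toℕ-cast eq i)

toℕ-↑ʳ-↑ˡ : ∀ j {m} q (i : Fin m) → toℕ (j ↑ʳ (i ↑ˡ q)) ≡ j + toℕ i
toℕ-↑ʳ-↑ˡ j q i = trans (toℕ-↑ʳ j (i ↑ˡ q)) (cong (j +_) (toℕ-↑ˡ i q))

suc-↑ʳ-↑ˡ : ∀ j {m} q (i : Fin m) (eq : suc j + (m + q) ≡ j + (suc m + q)) →
            subst Fin eq (suc j ↑ʳ (i ↑ˡ q)) ≡ j ↑ʳ (suc i ↑ˡ q)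
suc-↑ʳ-↑ˡ j q i eq = toℕ-injective (begin
  toℕ (subst Fin eq (suc j ↑ʳ (i ↑ˡ q))) ≡⟨ toℕ-subst eq _ ⟩
  toℕ (suc j ↑ʳ (i ↑ˡ q))                ≡⟨ toℕ-↑ʳ-↑ˡ (suc j) q i ⟩
  suc j + toℕ i                          ≡⟨ +-suc j (toℕ i) ⟨
  j + suc (toℕ i)                        ≡⟨ toℕ-↑ʳ-↑ˡ j q (suc i) ⟨
  toℕ (j ↑ʳ (suc i ↑ˡ q))                ∎)
  where open ≡-Reasoning

module IFSProperties (𝓘 : IFS) where
  open IFS 𝓘

  ids : (n : ℕ) → Vec (M n) n
  ids n = tabulate (proj n)

  infixl 6 _⊚_
  _⊚_ : ∀ {n p q} → Vec (M p) n → Vec (M q) p → Vec (M q) n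
  bs ⊚ cs = Vec.map (λ b → box _ _ b cs) bs

  tabulate-proj-⊚ : ∀ {m n q} (f : Fin m → Fin n) (cs : Vec (M q) n) →
                    tabulate (λ i → proj n (f i)) ⊚ cs ≡ tabulate (λ i → lookup cs (f i))
  tabulate-proj-⊚ f cs = trans (sym (tabulate-∘ _ _)) (tabulate-cong λ i → box-proj _ _ (f i) cs)

  ⊚-identityˡ : ∀ {n q} (cs : Vec (M q) n) → ids n ⊚ cs ≡ cs
  ⊚-identityˡ cs = trans (tabulate-proj-⊚ (λ i → i) cs) (tabulate∘lookup cs)

  ⊚-identityʳ : ∀ {n p} (bs : Vec (M p) n) → bs ⊚ ids p ≡ bs
  ⊚-identityʳ bs = trans (map-cong (box-id _) bs) (map-id bs)

  ⊚-assoc : ∀ {n p q r} (as : Vec (M p) n) (bs : Vec (M q) p) (cs : Vec (M r) q) →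
            (as ⊚ bs) ⊚ cs ≡ as ⊚ (bs ⊚ cs)
  ⊚-assoc as bs cs = trans (sym (map-∘ _ _ as)) (map-cong (λ a → box-assoc _ _ _ a bs cs) as)

  Sft-1-⊚-∷ : ∀ {n q} (c : M q) (cs : Vec (M q) n) → Sft 1 n ⊚ (c ∷ cs) ≡ cs
  Sft-1-⊚-∷ c cs = trans (tabulate-proj-⊚ (1 ↑ʳ_) (c ∷ cs)) (tabulate∘lookup cs)

  ⊚-η : ∀ {n q} (cs : Vec (M q) (suc n)) → box q (suc n) (proj (suc n) zero) cs ∷ Sft 1 n ⊚ cs ≡ cs
  ⊚-η (c ∷ cs) = cong₂ _∷_ (box-proj _ _ zero (c ∷ cs)) (Sft-1-⊚-∷ c cs)

  Sft-⊚-Sft-1 : ∀ j r → Sft j r ⊚ Sft 1 (j + r) ≡ Sft (suc j) r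
  Sft-⊚-Sft-1 j r = trans (tabulate-proj-⊚ (j ↑ʳ_) (Sft 1 (j + r)))
                          (tabulate-cong λ i → lookup∘tabulate _ (j ↑ʳ i))

module _ (L : Lang) where

  module FormulaSoundness (𝓜 : Model' L)
      (≈-sound : ∀ {s} {t u : Tm L s} → _≈_ L t u → ∀ ψ → ⟦_⟧T L 𝓜 t ψ ≡ ⟦_⟧T L 𝓜 u ψ) where
    open Model' 𝓜

    ≈PA-sound : ∀ {ks} {ts us : PArgs L ks} → _≈PA_ L ts us → ∀ ψ → ⟦_⟧PA L 𝓜 ts ψ ≡ ⟦_⟧PA L 𝓜 us ψ
    ≈PA-sound []       ψ = refl
    ≈PA-sound (e ∷ es) ψ = cong₂ _,_ (≈-sound e ψ) (≈PA-sound es ψ)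

    ≈F-sound : ∀ {A B} → _≈F_ L A B → ∀ ψ → ⟦_⟧F L 𝓜 A ψ ⇔ ⟦_⟧F L 𝓜 B ψ
    ≈F-sound ≈F-refl             ψ = ⇔-id _
    ≈F-sound (≈F-sym e)          ψ = ⇔-sym (≈F-sound e ψ)
    ≈F-sound (≈F-trans e e')     ψ = ≈F-sound e' ψ ⇔-∘ ≈F-sound e ψ
    ≈F-sound (atom-cong {P} es)  ψ = ≡⇒ (cong (λ v → predI P v ≡ true) (≈PA-sound es ψ))
    ≈F-sound (¬-cong e)          ψ = ¬-cong-⇔ (≈F-sound e ψ)
    ≈F-sound (∧-cong e e')       ψ = ≈F-sound e ψ ×-⇔ ≈F-sound e' ψ
    ≈F-sound (∨-cong e e')       ψ = ≈F-sound e ψ ⊎-⇔ ≈F-sound e' ψ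
    ≈F-sound (⇒-cong e e')       ψ = →-cong-⇔ (≈F-sound e ψ) (≈F-sound e' ψ)
    ≈F-sound (∀-cong e)          ψ = Π-⇔ λ a → ≈F-sound e _
    ≈F-sound (∃-cong e)          ψ = Σ-⇔ (↠-id _) (≈F-sound e _)

  module CanonicalModel (𝓑 : BindingModel L) where
    open BindingModel 𝓑
    open IFSProperties ifs

    canonical : Model' L
    canonical = record
      { D      = D
      ; fnI    = fhat
      ; predI  = Phat
      ; cstI   = proj
      ; substI = box
      ; idI    = ids
      ; consI  = λ _ _ → _∷_
      ; upI    = Sft 1
      ; compI  = λ _ _ _ → _⊚_
      }
      where
      D : Sort L → Set
      D (tm n)   = M n
      D (sb n p) = Vec (M n) p

    open Model' canonical using (D)

    ⟦_⟧ : ∀ {s} → Tm L s → Asg L canonical → D s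
    ⟦ t ⟧ = ⟦_⟧T L canonical t

    ⟦_⟧A : ∀ {p ks} → TArgs L p ks → Asg L canonical → Prod (λ k → M (k + p)) ks
    ⟦ ts ⟧A = ⟦_⟧TA L canonical ts

    ⟦sh⟧ : ∀ r j ψ → ⟦ sh L r j ⟧ ψ ≡ Sft j r
    ⟦sh⟧ r zero          ψ = refl
    ⟦sh⟧ r (suc zero)    ψ = refl
    ⟦sh⟧ r (suc (suc j)) ψ =
      trans (cong (_⊚ Sft 1 (suc j + r)) (⟦sh⟧ r (suc j) ψ)) (Sft-⊚-Sft-1 (suc j) r)

    ⟦entry⟧ : ∀ r j ψ → ⟦ entry L r j ⟧ ψ ≡ proj (j + suc r) (j ↑ʳ zero)
    ⟦entry⟧ r zero    ψ = refl
    ⟦entry⟧ r (suc j) ψ = begin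
      box _ _ (proj (suc r) zero) (⟦ sh L (suc r) (suc j) ⟧ ψ) ≡⟨ box-proj _ _ zero _ ⟩
      lookup (⟦ sh L (suc r) (suc j) ⟧ ψ) zero                 ≡⟨ cong (λ v → lookup v zero) (⟦sh⟧ (suc r) (suc j) ψ) ⟩
      lookup (Sft (suc j) (suc r)) zero                        ≡⟨⟩
      proj (suc j + suc r) (suc j ↑ʳ zero)                     ∎
      where open ≡-Reasoning

    ⟦chainFrom⟧ : ∀ {N p} q j m (eq : j + (m + q) ≡ N) (tl : Tm L (sb N p)) ψ →
                  ⟦ chainFrom L q j m eq tl ⟧ ψ
                  ≡ tabulate (λ i → proj N (subst Fin eq (j ↑ʳ (i ↑ˡ q)))) ++ ⟦ tl ⟧ ψ
    ⟦chainFrom⟧ q j zero    eq   tl ψ = refl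
    ⟦chainFrom⟧ q j (suc m) refl tl ψ = cong₂ _∷_ (⟦entry⟧ (m + q) j ψ)
      (trans (⟦chainFrom⟧ q (suc j) m _ tl ψ)
             (cong (_++ ⟦ tl ⟧ ψ) (tabulate-cong λ i → cong (proj _) (suc-↑ʳ-↑ˡ j q i _))))

    ⟦chain⟧ : ∀ {q p} k (s : Tm L (sb q p)) ψ → ⟦ chain L k s ⟧ ψ ≡ liftV k q p (⟦ s ⟧ ψ)
    ⟦chain⟧ {q} k s ψ = trans (⟦chainFrom⟧ q 0 k refl (s ∘ₛ sh L q k) ψ)
      (cong (λ σ → tabulate (λ j → proj (k + q) (j ↑ˡ q)) ++ ⟦ s ⟧ ψ ⊚ σ) (⟦sh⟧ q k ψ))

    ⟦pushArgs⟧ : ∀ {p q ks} (s : Tm L (sb q p)) (ts : TArgs L p ks) ψ →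
                 ⟦ pushArgs L s ts ⟧A ψ
                 ≡ mapProd (λ k a → box (k + q) (k + p) a (liftV k q p (⟦ s ⟧ ψ))) ks (⟦ ts ⟧A ψ)
    ⟦pushArgs⟧ s []             ψ = refl
    ⟦pushArgs⟧ s (_∷_ {k} t ts) ψ =
      cong₂ _,_ (cong (box _ _ (⟦ t ⟧ ψ)) (⟦chain⟧ k s ψ)) (⟦pushArgs⟧ s ts ψ)

    rule-sound : ∀ {s} {t u : Tm L s} → Rule L t u → ∀ ψ → ⟦ t ⟧ ψ ≡ ⟦ u ⟧ ψ
    rule-sound (r-varshift {r} {n}) ψ = sym (⟦entry⟧ r (suc n) ψ)
    rule-sound (r-varcons t s)      ψ = box-proj _ _ zero _
    rule-sound (r-id t)             ψ = box-id _ _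
    rule-sound (r-clos t s s')      ψ = box-assoc _ _ _ _ _ _
    rule-sound (r-idl s)            ψ = ⊚-identityˡ (⟦ s ⟧ ψ)
    rule-sound (r-shiftcons t s)    ψ = Sft-1-⊚-∷ (⟦ t ⟧ ψ) (⟦ s ⟧ ψ)
    rule-sound (r-ass s₁ s₂ s₃)     ψ = ⊚-assoc (⟦ s₁ ⟧ ψ) (⟦ s₂ ⟧ ψ) (⟦ s₃ ⟧ ψ)
    rule-sound (r-map t s s')       ψ = refl
    rule-sound (r-idr s)            ψ = ⊚-identityʳ (⟦ s ⟧ ψ)
    rule-sound r-varid              ψ = refl
    rule-sound (r-scons s)          ψ = ⊚-η (⟦ s ⟧ ψ)
    rule-sound (r-fun f p q ts s)   ψ =
      trans (fhat-box f p q _ _) (cong (fhat f q) (sym (⟦pushArgs⟧ s ts ψ)))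

    mutual
      ≈-sound : ∀ {s} {t u : Tm L s} → _≈_ L t u → ∀ ψ → ⟦ t ⟧ ψ ≡ ⟦ u ⟧ ψ
      ≈-sound (rule r)              ψ = rule-sound r ψ
      ≈-sound ≈-refl                ψ = refl
      ≈-sound (≈-sym e)             ψ = sym (≈-sound e ψ)
      ≈-sound (≈-trans e e')        ψ = trans (≈-sound e ψ) (≈-sound e' ψ)
      ≈-sound (fn-cong {f} {p} es)  ψ = cong (fhat f p) (≈A-sound es ψ)
      ≈-sound (sub-cong e e')       ψ = cong₂ (box _ _) (≈-sound e ψ) (≈-sound e' ψ)
      ≈-sound (cons-cong e e')      ψ = cong₂ _∷_ (≈-sound e ψ) (≈-sound e' ψ)
      ≈-sound (comp-cong e e')      ψ = cong₂ _⊚_ (≈-sound e ψ) (≈-sound e' ψ)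

      ≈A-sound : ∀ {p ks} {ts us : TArgs L p ks} → _≈A_ L ts us → ∀ ψ → ⟦ ts ⟧A ψ ≡ ⟦ us ⟧A ψ
      ≈A-sound []       ψ = refl
      ≈A-sound (e ∷ es) ψ = cong₂ _,_ (≈-sound e ψ) (≈A-sound es ψ)

    mutual
      ⟦cook⟧ : ∀ (t : Term L) {p} (l : Vec ℕ p) ψ → ⟦ cook L t l ⟧ ψ ≡ ⟦_⟧t L 𝓑 t l (ψ (tm 0))
      ⟦cook⟧ (var x) l ψ with firstPos x l
      ... | just i  = refl
      ... | nothing = cong (box _ 0 (ψ (tm 0) x)) ([]-unique _)
      ⟦cook⟧ (app f as) {p} l ψ = cong (fhat f p) (⟦cookArgs⟧ as l ψ)

      ⟦cookArgs⟧ : ∀ {ks} (as : Args L ks) {p} (l : Vec ℕ p) ψ →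
                   ⟦ cookArgs L as l ⟧A ψ ≡ ⟦_⟧as L 𝓑 as l (ψ (tm 0))
      ⟦cookArgs⟧ []            l ψ = refl
      ⟦cookArgs⟧ (arg ys t as) l ψ = cong₂ _,_ (⟦cook⟧ t _ ψ) (⟦cookArgs⟧ as l ψ)

    ⟦cookPArgs⟧ : ∀ {ks} (as : Args L ks) ψ → ⟦_⟧PA L canonical (cookPArgs L as) ψ ≡ ⟦_⟧pa L 𝓑 as (ψ (tm 0))
    ⟦cookPArgs⟧ []            ψ = refl
    ⟦cookPArgs⟧ (arg ys t as) ψ = cong₂ _,_ (⟦cook⟧ t _ ψ) (⟦cookPArgs⟧ as ψ)

    translate-sound : ∀ A ψ → ⟦_⟧F L canonical (translate L A) ψ ⇔ ⟦_⟧f L 𝓑 A (ψ (tm 0))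
    translate-sound (atom P as) ψ = ≡⇒ (cong (λ v → Phat P v ≡ true) (⟦cookPArgs⟧ as ψ))
    translate-sound ⊤f          ψ = ⇔-id _
    translate-sound ⊥f          ψ = ⇔-id _
    translate-sound (¬f A)      ψ = ¬-cong-⇔ (translate-sound A ψ)
    translate-sound (A ∧f B)    ψ = translate-sound A ψ ×-⇔ translate-sound B ψ
    translate-sound (A ∨f B)    ψ = translate-sound A ψ ⊎-⇔ translate-sound B ψ
    translate-sound (A ⇒f B)    ψ = →-cong-⇔ (translate-sound A ψ) (translate-sound B ψ)
    translate-sound (∀f x A)    ψ = Π-⇔ λ a → translate-sound A _
    translate-sound (∃f x A)    ψ = Σ-⇔ (↠-id _) (translate-sound A _)

    -- Translated propositions only mention variables of sort 0, so the other sorts may be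
    -- given arbitrary values.
    extend : (ℕ → M 0) → Asg L canonical
    extend φ (tm zero)    = φ
    extend φ (tm (suc n)) _ = box (suc n) 0 (φ 0) []
    extend φ (sb n p)     _ = replicate p (box n 0 (φ 0) [])

    Valid'-translate⇒Valid : ∀ A → Valid' L canonical (translate L A) → Valid L 𝓑 A
    Valid'-translate⇒Valid A ⊨A' φ = Equivalence.to (translate-sound A (extend φ)) (⊨A' (extend φ))

    Valid⇒Valid'-translate : ∀ A → Valid L 𝓑 A → Valid' L canonical (translate L A)
    Valid⇒Valid'-translate A ⊨A ψ = Equivalence.from (translate-sound A ψ) (⊨A (ψ (tm 0)))

    canonical-isModelModulo : ∀ Γ → IsModelOf L 𝓑 Γ → IsModelModulo L canonical (map (translate L) Γ)
    canonical-isModelModulo Γ 𝓑⊨Γ = record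
      { congr-tm = ≈-sound
      ; congr-fm = λ A≈B ψ → let A⇔B = ≈F-sound A≈B ψ in Equivalence.to A⇔B , Equivalence.from A⇔B
      ; valid-Γ' = λ A' A'∈Γ' → valid-translate (∈-map⁻ (translate L) A'∈Γ')
      }
      where
      open FormulaSoundness canonical ≈-sound
      valid-translate : ∀ {A'} → Σ (Formula L) (λ A → A ∈ Γ × A' ≡ translate L A) → Valid' L canonical A'
      valid-translate (A , A∈Γ , refl) = Valid⇒Valid'-translate A (𝓑⊨Γ A A∈Γ)

mainTheorem5 : (L : Lang) (Γ Δ : List (Formula L)) →
    ((𝓜' : Model' L) → IsModelModulo L 𝓜' (map (translate L) Γ) →
      Any (Valid' L 𝓜') (map (translate L) Δ)) →
    (𝓜 : BindingModel L) → IsModelOf L 𝓜 Γ → Any (Valid L 𝓜) Δ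
mainTheorem5 L Γ Δ Δ'-valid 𝓑 𝓑⊨Γ =
  Any.map (λ {A} → Valid'-translate⇒Valid A)
    (Any.map⁻ (Δ'-valid canonical (canonical-isModelModulo Γ 𝓑⊨Γ)))
  where open CanonicalModel L 𝓑
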